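{- For every $\kappa\in K_2(\mathbb{Q}(T))$ there exist a finite set $\Sigma$ of rational points of $S^1$ and a locally constant function $n=n_\kappa\colon S^1\setminus\Sigma\to\mathbb{Z}$ with the following property. For every primitive $\lambda\in X$ with $\mathbb{R}_+\lambda\notin\Sigma$, the residue (tame symbol) of $\kappa$ along $D_\lambda\cong\mathbb{G}_m$ has the form $c\,z^{n(\mathbb{R}_+\lambda)}$ for some $c\in\mathbb{Q}^\times$, where $z$ is the coordinate on $\mathbb{G}_m$.
   Context: Let $T=\mathbb{G}_m^2$ over $\mathbb{Q}$, viewed as $\mathrm{Spec}\,\mathbb{Q}[X^*]$, with function field $\mathbb{Q}(T)$. Here $X=X_*(T)\cong\mathbb{Z}^2$ is the cocharacter lattice and $X^*$ the character lattice, with the natural pairing $\langle\,,\rangle\colon X\times X^*\to\mathbb{Z}$. Fix an orientation of $X_{\mathbb{R}}=X\otimes\mathbb{R}$, giving an identification $\wedge^2X\cong\mathbb{Z}$; write $x\wedge y\in\mathbb{Z}$. For primitive $\lambda\in X$: - let $V_\lambda=\{\chi\in X^*:\langle\lambda,\chi\rangle\le0\}$ and $T_\lambda=\mathrm{Spec}\,\mathbb{Q}[V_\lambda]$, a partial toric compactification containing $T$ as an open subscheme; - $D_\lambda=T_\lambda\setminus T$ is an irreducible divisor, $T$-equivariantly identified with $T/\lambda(\mathbb{G}_m)$; - choosing $\mu\in X$ with $\mu\wedge\lambda=1$ identifies $D_\lambda$ with $\mathbb{G}_m$ via $\mathbb{G}_m\xrightarrow{\mu}T\to T/\lambda(\mathbb{G}_m)$;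 - the residue along $D_\lambda$ is the tame symbol $K_2(\mathbb{Q}(T))\to\mathbb{Q}(D_\lambda)^\times$ for the discrete valuation of $\mathbb{Q}(T)$ defined by $D_\lambda$. $S^1=(X_{\mathbb{R}}\setminus\{0\})/\mathbb{R}_+$ is the circle of rays. A point of $S^1$ is rational if it is the ray $\mathbb{R}_+x$ for some nonzero $x\in X$. -}

module Defs where

open import Data.Nat as ℕ using (ℕ; zero; suc)
open import Data.Nat.GCD using (gcd)
import Data.Nat.DivMod as ℕD
open import Data.Integer as ℤ using (ℤ; +_; -[1+_]; ∣_∣; _⊓_)
open import Data.Rational as ℚ using (ℚ; 0ℚ; 1ℚ)
open import Data.Product using (Σ; _×_; _,_; proj₁; proj₂; ∃)
open import Data.List using (List; []; _∷_; _++_; map; concatMap; filter; foldr; replicate)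
open import Data.List.Relation.Unary.All using (All)
open import Data.List.Relation.Unary.Any using (Any)
open import Data.Bool using (Bool; true; false; if_then_else_)
open import Relation.Nullary using (¬_; Dec; yes; no; ⌊_⌋)
open import Relation.Binary.PropositionalEquality using (_≡_; _≢_)

-- Lattices.  X = X_*(T) and X^* are both identified with ℤ × ℤ via dual
-- bases; the pairing is the dot product and the orientation of X_ℝ is
-- the standard one, so x ∧ y = x₁ y₂ - x₂ y₁.

Vec2 : Set
Vec2 = ℤ × ℤ

⟪_,_⟫ : Vec2 → Vec2 → ℤ
⟪ (a , b ) , (c , d) ⟫ = a ℤ.* c ℤ.+ b ℤ.* d

_∧_ : Vec2 → Vec2 → ℤ
(a , b) ∧ (c , d) = a ℤ.* d ℤ.- b ℤ.* c

NonzeroV : Vec2 → Set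
NonzeroV (a , b) = ¬ (a ≡ + 0 × b ≡ + 0)

Primitive : Vec2 → Set
Primitive (a , b) = gcd ∣ a ∣ ∣ b ∣ ≡ 1

_≟v_ : (x y : Vec2) → Dec (x ≡ y)
(a , b) ≟v (c , d) with a ℤ.≟ c | b ℤ.≟ d
... | yes _≡_.refl | yes _≡_.refl = yes _≡_.refl
... | no p | _ = no λ { _≡_.refl → p _≡_.refl }
... | yes _ | no q = no λ { _≡_.refl → q _≡_.refl }

-- The circle of rays S¹ = (X_ℝ ∖ 0)/ℝ₊, at rational points.

SameRay : Vec2 → Vec2 → Set
SameRay (a , b) (c , d) =
  Σ ℕ λ k → Σ ℕ λ l → (+ suc k ℤ.* a ≡ + suc l ℤ.* c) × (+ suc k ℤ.* b ≡ + suc l ℤ.* d)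

-- "half" of the ray v relative to base ray λ: 0 if the counterclockwise
-- angle from λ to v lies in [0,π), 1 if it lies in [π,2π).
-- (Angle in [0,π) iff λ∧v > 0, or λ∧v = 0 and v points the same way as λ.)
half : Vec2 → Vec2 → ℕ
half l v with ⌊ + 0 ℤ.<? (l ∧ v) ⌋ | ⌊ (l ∧ v) ℤ.≟ + 0 ⌋ | ⌊ + 0 ℤ.<? ⟪ l , v ⟫ ⌋
... | true  | _    | _    = 0
... | false | true | true = 0
... | _     | _    | _    = 1

-- the counterclockwise angle from λ to u is strictly smaller than that to v
AngleLT : Vec2 → Vec2 → Vec2 → Set
AngleLT l u v = (half l u ℕ.< half l v) Data.Sum.⊎ ((half l u ≡ half l v) × (+ 0 ℤ.< u ∧ v))
  where import Data.Sum

InOpenArc : Vec2 → Vec2 → Vec2 → Set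
InOpenArc l l' σ = AngleLT l l σ × AngleLT l σ l'

OffRays : List Vec2 → Vec2 → Set
OffRays Σs l = All (λ σ → ¬ SameRay σ l) Σs

-- n (given on rational rays ∉ Σ via primitive representatives) is the
-- restriction of a locally constant function S¹ ∖ Σ → ℤ: it is constant on
-- every connected component (open arc) of S¹ ∖ Σ.
LocallyConstantOff : List Vec2 → (Vec2 → ℤ) → Set
LocallyConstantOff Σs n =
  ∀ l l' → Primitive l → Primitive l' → OffRays Σs l → OffRays Σs l' →
  All (λ σ → ¬ InOpenArc l l' σ) Σs → n l ≡ n l'

-- Laurent polynomials in two variables: ℚ[X^*], as formal lists of
-- terms c·t^χ (coefficients of equal exponents add).

LP2 : Set
LP2 = List (ℚ × Vec2)

coeff2 : LP2 → Vec2 → ℚ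
coeff2 [] χ = 0ℚ
coeff2 ((c , χ') ∷ p) χ = if ⌊ χ' ≟v χ ⌋ then c ℚ.+ coeff2 p χ else coeff2 p χ

NonzeroLP2 : LP2 → Set
NonzeroLP2 p = Σ Vec2 λ χ → coeff2 p χ ≢ 0ℚ

support : LP2 → List Vec2
support p = filter (λ χ → Relation.Nullary.¬? (coeff2 p χ ℚ.≟ 0ℚ)) (map proj₂ p)
  where import Relation.Nullary

minℤ : List ℤ → ℤ
minℤ [] = + 0
minℤ (x ∷ []) = x
minℤ (x ∷ y ∷ xs) = x ⊓ minℤ (y ∷ xs)

-- valuation of ℚ(T) along D_λ on a (nonzero) Laurent polynomial:
-- v_λ(t^χ) = -⟨λ,χ⟩ (t^χ regular on T_λ iff ⟨λ,χ⟩ ≤ 0), and v_λ of a sum is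
-- the minimum over the support.
val : Vec2 → LP2 → ℤ
val l p = minℤ (map (λ χ → ℤ.- ⟪ l , χ ⟫) (support p))

record RatFun× : Set where
  field
    num den : LP2
    num≢0 : NonzeroLP2 num
    den≢0 : NonzeroLP2 den
open RatFun× public

valF : Vec2 → RatFun× → ℤ
valF l f = val l (num f) ℤ.- val l (den f)

-- An element of K₂(ℚ(T)) is a finite sum of Steinberg symbols {f,g}
-- (every element of K₂ of a field is such a sum); we quantify over such
-- presentations.
Symbol : Set
Symbol = RatFun× × RatFun×

-- Laurent polynomials in one variable z (coordinate on D_λ ≅ 𝔾_m).

LP1 : Set
LP1 = List (ℚ × ℤ)

coeff1 : LP1 → ℤ → ℚ
coeff1 [] k = 0ℚ
coeff1 ((c , e) ∷ p) k = if ⌊ e ℤ.≟ k ⌋ then c ℚ.+ coeff1 p k else coeff1 p k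

_≈₁_ : LP1 → LP1 → Set
p ≈₁ q = ∀ k → coeff1 p k ≡ coeff1 q k

mul1 : LP1 → LP1 → LP1
mul1 p q = concatMap (λ { (c , e) → map (λ { (d , f) → (c ℚ.* d , e ℤ.+ f) }) q }) p

prod1 : List LP1 → LP1
prod1 = foldr mul1 ((1ℚ , + 0) ∷ [])

-- Restriction to D_λ (identified with 𝔾_m via μ, μ ∧ λ = 1) of the initial
-- part of p: the terms c t^χ with -⟨λ,χ⟩ = v_λ(p), written as c z^⟨μ,χ⟩
-- (the remaining factor is a power of the monomial of weight -1, which
-- cancels in the weight-zero combination defining the tame symbol).
initRestr : Vec2 → Vec2 → LP2 → LP1
initRestr l m p =
  map (λ { (c , χ) → (c , ⟪ m , χ ⟫) })
      (filter (λ t → (ℤ.- ⟪ l , proj₂ t ⟫) ℤ.≟ val l p) p)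

-- a rational function of z, as (numerator factors , denominator factors)
Frac1 : Set
Frac1 = List LP1 × List LP1

_⊗_ : Frac1 → Frac1 → Frac1
(a , b) ⊗ (c , d) = (a ++ c , b ++ d)

powFrac : LP1 → LP1 → ℤ → Frac1
powFrac P Q (+ k) = (replicate k P , replicate k Q)
powFrac P Q -[1+ k ] = (replicate (suc k) Q , replicate (suc k) P)

-- tame symbol  ∂_λ{f,g} = (-1)^{v(f)v(g)} f^{v(g)} / g^{v(f)}  restricted to D_λ
tameSymbol : Vec2 → Vec2 → Symbol → Frac1
tameSymbol l m (f , g) =
  signF ⊗ (powFrac (initRestr l m (num f)) (initRestr l m (den f)) b
        ⊗ powFrac (initRestr l m (num g)) (initRestr l m (den g)) (ℤ.- a))
  where
  a = valF l f
  b = valF l g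
  signF : Frac1
  signF = if ⌊ ∣ a ℤ.* b ∣ ℕD.% 2 ℕ.≟ 1 ⌋
          then (((ℚ.- 1ℚ , + 0) ∷ []) ∷ [] , [])
          else ([] , [])

residue : Vec2 → Vec2 → List Symbol → Frac1
residue l m [] = ([] , [])
residue l m (s ∷ κ) = tameSymbol l m s ⊗ residue l m κ

IsMonomial : Frac1 → ℚ → ℤ → Set
IsMonomial (N , D) c n = prod1 N ≈₁ mul1 ((c , n) ∷ []) (prod1 D)

{-# OPTIONS --safe #-}
module Submission where

-- If a direction λ is not orthogonal to any difference of two exponents of a
-- Laurent polynomial p, then ⟨λ,_⟩ attains its maximum on the support of p at a
-- single exponent χ_λ(p), a vertex of the Newton polygon.  Hence v_λ(p) = -⟨λ,χ_λ(p)⟩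
-- and the initial part of p restricted to D_λ is one monomial c z^⟨μ,χ_λ(p)⟩.  With
-- α, β the differences χ_λ(num) - χ_λ(den) for f and g, the tame symbol of {f,g} is
-- then c z^e with e = ⟨λ,α⟩⟨μ,β⟩ - ⟨λ,β⟩⟨μ,α⟩ = (μ∧λ)(β∧α) = β∧α.
-- Σ consists of the rays of perp(u - w) for distinct exponents u, w of one polynomial.
-- On an arc avoiding Σ the vertex χ_λ(p) cannot jump from u to w: otherwise
-- λ ∧ perp(u - w) = ⟨λ,u - w⟩ > 0 > ⟨λ′,u - w⟩ would put that ray between λ and λ′.

open import Defs
open import Data.Bool using (true; false; if_then_else_)
open import Data.Empty using (⊥-elim)
open import Data.Integer as ℤ using (ℤ; +_; -[1+_]; _+_; _-_; _*_; -_; _<_; _≤_; _≟_; _<?_)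
import Data.Integer.Properties as ℤ
open import Data.Integer.Tactic.RingSolver using (solve-∀)
open import Data.List
  using (List; []; _∷_; _++_; map; filter; concatMap; replicate; cartesianProductWith)
open import Data.List.Extrema ℤ.≤-totalOrder
  using (argmax; argmax-sel; f[⊥]≤f[argmax]; f[xs]≤f[argmax])
open import Data.List.Membership.Propositional using (_∈_)
open import Data.List.Membership.Propositional.Properties
  using (∈-filter⁺; ∈-filter⁻; ∈-map⁺; ∈-cartesianProductWith⁺)
open import Data.List.Relation.Unary.All as All using (All; []; _∷_)
import Data.List.Relation.Unary.All.Properties as All
open import Data.List.Relation.Binary.Subset.Propositional using (_⊆_)
open import Data.List.Relation.Unary.Any using (here; there)
import Data.Nat as ℕ
open import Data.Product using (Σ; _×_; _,_; proj₁; proj₂; map₂)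
open import Data.Rational as ℚ using (ℚ; 0ℚ; 1ℚ)
import Data.Rational.Properties as ℚ
open import Data.Sum using (_⊎_; inj₁; inj₂; [_,_]′)
open import Function using (_∘_)
open import Relation.Binary.PropositionalEquality
open import Relation.Nullary using (¬_; Dec; yes; no; ⌊_⌋; ¬?)
open import Relation.Nullary.Decidable using (_×-dec_; decidable-stable)

-- Monomials in one variable

*-≢0 : ∀ {p q : ℚ} → p ≢ 0ℚ → q ≢ 0ℚ → p ℚ.* q ≢ 0ℚ
*-≢0 {p} {q} p≢0 q≢0 pq≡0 = q≢0 (begin
    q                         ≡⟨ ℚ.*-identityˡ q ⟨
    1ℚ ℚ.* q                  ≡⟨ cong (ℚ._* q) (ℚ.*-inverseˡ p) ⟨
    ℚ.1/ p ℚ.* p ℚ.* q        ≡⟨ ℚ.*-assoc (ℚ.1/ p) p q ⟩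
    ℚ.1/ p ℚ.* (p ℚ.* q)      ≡⟨ cong (ℚ.1/ p ℚ.*_) pq≡0 ⟩
    ℚ.1/ p ℚ.* 0ℚ             ≡⟨ ℚ.*-zeroʳ (ℚ.1/ p) ⟩
    0ℚ                        ∎)
  where
  open ≡-Reasoning
  instance _ = ℚ.≢-nonZero p≢0

total : {A : Set} → List (ℚ × A) → ℚ
total []       = 0ℚ
total (t ∷ ts) = proj₁ t ℚ.+ total ts

Homogeneous : {A : Set} → A → List (ℚ × A) → Set
Homogeneous e = All (λ t → proj₂ t ≡ e)

total-++ : {A : Set} (xs ys : List (ℚ × A)) → total (xs ++ ys) ≡ total xs ℚ.+ total ys
total-++ []       ys = sym (ℚ.+-identityˡ (total ys))
total-++ (t ∷ xs) ys = trans (cong (proj₁ t ℚ.+_) (total-++ xs ys)) (sym (ℚ.+-assoc (proj₁ t) _ _))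

total-map₂ : {A B : Set} (f : A → B) (xs : List (ℚ × A)) → total (map (map₂ f) xs) ≡ total xs
total-map₂ f []       = refl
total-map₂ f (t ∷ xs) = cong (proj₁ t ℚ.+_) (total-map₂ f xs)

homogeneous-map₂ : {A B : Set} (f : A → B) {e : A} {xs : List (ℚ × A)} →
                   Homogeneous e xs → Homogeneous (f e) (map (map₂ f) xs)
homogeneous-map₂ f h = All.map⁺ (All.map (cong f) h)

_*ₜ_ : ℚ × ℤ → ℚ × ℤ → ℚ × ℤ
(c , d) *ₜ (c′ , e) = (c ℚ.* c′ , d + e)

total-*ₜ : ∀ t Q → total (map (t *ₜ_) Q) ≡ proj₁ t ℚ.* total Q
total-*ₜ t []       = sym (ℚ.*-zeroʳ (proj₁ t))
total-*ₜ t (u ∷ Q) = trans (cong (proj₁ t ℚ.* proj₁ u ℚ.+_) (total-*ₜ t Q))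
                           (sym (ℚ.*-distribˡ-+ (proj₁ t) (proj₁ u) (total Q)))

total-mul1 : ∀ P Q → total (mul1 P Q) ≡ total P ℚ.* total Q
total-mul1 []      Q = sym (ℚ.*-zeroˡ (total Q))
total-mul1 (t ∷ P) Q = begin
  total (map (t *ₜ_) Q ++ mul1 P Q)              ≡⟨ total-++ (map (t *ₜ_) Q) (mul1 P Q) ⟩
  total (map (t *ₜ_) Q) ℚ.+ total (mul1 P Q)     ≡⟨ cong₂ ℚ._+_ (total-*ₜ t Q) (total-mul1 P Q) ⟩
  proj₁ t ℚ.* total Q ℚ.+ total P ℚ.* total Q    ≡⟨ ℚ.*-distribʳ-+ (total Q) (proj₁ t) (total P) ⟨
  (proj₁ t ℚ.+ total P) ℚ.* total Q              ∎
  where open ≡-Reasoning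

homogeneous-mul1 : ∀ {d e P Q} → Homogeneous d P → Homogeneous e Q → Homogeneous (d + e) (mul1 P Q)
homogeneous-mul1 []         hQ = []
homogeneous-mul1 (d≡ ∷ hP) hQ =
  All.++⁺ (All.map⁺ (All.map (cong₂ _+_ d≡) hQ)) (homogeneous-mul1 hP hQ)

coeff1-homogeneous : ∀ {e P} → Homogeneous e P → ∀ k →
                     coeff1 P k ≡ (if ⌊ e ≟ k ⌋ then total P else 0ℚ)
coeff1-homogeneous {e} [] k with ⌊ e ≟ k ⌋
... | true  = refl
... | false = refl
coeff1-homogeneous {P = t ∷ P} (refl ∷ hP) k with ⌊ proj₂ t ≟ k ⌋ | coeff1-homogeneous hP k
... | true  | ih = cong (proj₁ t ℚ.+_) ih
... | false | ih = ih

homogeneous-≈₁ : ∀ {e P Q} → Homogeneous e P → Homogeneous e Q → total P ≡ total Q → P ≈₁ Q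
homogeneous-≈₁ {e} hP hQ eq k =
  trans (coeff1-homogeneous hP k)
        (trans (cong (λ c → if ⌊ e ≟ k ⌋ then c else 0ℚ) eq) (sym (coeff1-homogeneous hQ k)))

Monomial : ℤ → LP1 → Set
Monomial e P = Homogeneous e P × total P ≢ 0ℚ

monomial-mul1 : ∀ {d e P Q} → Monomial d P → Monomial e Q → Monomial (d + e) (mul1 P Q)
monomial-mul1 {P = P} {Q} (hP , P≢0) (hQ , Q≢0) =
  homogeneous-mul1 hP hQ , subst (_≢ 0ℚ) (sym (total-mul1 P Q)) (*-≢0 P≢0 Q≢0)

data Monomials : List LP1 → ℤ → Set where
  []  : Monomials [] (+ 0)
  _∷_ : ∀ {d e P Ps} → Monomial d P → Monomials Ps e → Monomials (P ∷ Ps) (d + e)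

monomial-prod1 : ∀ {Ps e} → Monomials Ps e → Monomial e (prod1 Ps)
monomial-prod1 []       = refl ∷ [] , λ ()
monomial-prod1 (m ∷ ms) = monomial-mul1 m (monomial-prod1 ms)

monomials-++ : ∀ {Ps Qs d e} → Monomials Ps d → Monomials Qs e → Monomials (Ps ++ Qs) (d + e)
monomials-++ {e = e} [] ns = subst (Monomials _) (sym (ℤ.+-identityˡ e)) ns
monomials-++ {e = e} (_∷_ {d₁} {d₂} m ms) ns =
  subst (Monomials _) (sym (ℤ.+-assoc d₁ d₂ e)) (m ∷ monomials-++ ms ns)

monomials-replicate : ∀ {d P} → Monomial d P → ∀ k → Monomials (replicate k P) (+ k * d)
monomials-replicate m ℕ.zero    = []
monomials-replicate {d} m (ℕ.suc k) =
  subst (Monomials _) (sym (ℤ.suc-* (+ k) d)) (m ∷ monomials-replicate m k)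

infix 4 _/_
data MonomialFrac : Frac1 → ℤ → Set where
  _/_ : ∀ {N D d e} → Monomials N d → Monomials D e → MonomialFrac (N , D) (d - e)

monomialFrac-⊗ : ∀ {F G d e} → MonomialFrac F d → MonomialFrac G e → MonomialFrac (F ⊗ G) (d + e)
monomialFrac-⊗ (_/_ {d = a} {b} m n) (_/_ {d = c} {e} m′ n′) =
  subst (MonomialFrac _) (regroup a b c e) (monomials-++ m m′ / monomials-++ n n′)
  where
  regroup : ∀ a b c e → (a + c) - (b + e) ≡ (a - b) + (c - e)
  regroup = solve-∀

monomialFrac-powFrac : ∀ {d e P Q} → Monomial d P → Monomial e Q → ∀ k →
                       MonomialFrac (powFrac P Q k) (k * (d - e))
monomialFrac-powFrac {d} {e} mP mQ (+ k) =
  subst (MonomialFrac _) (distrib (+ k) d e)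
        (monomials-replicate mP k / monomials-replicate mQ k)
  where
  distrib : ∀ x d e → x * d - x * e ≡ x * (d - e)
  distrib = solve-∀
monomialFrac-powFrac {d} {e} mP mQ -[1+ k ] =
  subst (MonomialFrac _) (distrib (+ ℕ.suc k) d e)
        (monomials-replicate mQ (ℕ.suc k) / monomials-replicate mP (ℕ.suc k))
  where
  distrib : ∀ x d e → x * e - x * d ≡ (- x) * (d - e)
  distrib = solve-∀

monomialFrac-sign : ∀ b →
  MonomialFrac (if b then ((((ℚ.- 1ℚ) , + 0) ∷ []) ∷ [] , []) else ([] , [])) (+ 0)
monomialFrac-sign true  = ((refl ∷ []) , λ ()) ∷ [] / []
monomialFrac-sign false = [] / []

nonzero-quotient : ∀ {ν δ : ℚ} → ν ≢ 0ℚ → δ ≢ 0ℚ → Σ ℚ λ c → c ≢ 0ℚ × c ℚ.* δ ≡ ν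
nonzero-quotient {ν} {δ} ν≢0 δ≢0 = ν ℚ.* ℚ.1/ δ , c≢0 , c*δ≡ν
  where
  open ≡-Reasoning
  instance _ = ℚ.≢-nonZero δ≢0
  c*δ≡ν : ν ℚ.* ℚ.1/ δ ℚ.* δ ≡ ν
  c*δ≡ν = begin
    ν ℚ.* ℚ.1/ δ ℚ.* δ      ≡⟨ ℚ.*-assoc ν (ℚ.1/ δ) δ ⟩
    ν ℚ.* (ℚ.1/ δ ℚ.* δ)    ≡⟨ cong (ν ℚ.*_) (ℚ.*-inverseˡ δ) ⟩
    ν ℚ.* 1ℚ                ≡⟨ ℚ.*-identityʳ ν ⟩
    ν                       ∎
  c≢0 : ν ℚ.* ℚ.1/ δ ≢ 0ℚ
  c≢0 c≡0 = ν≢0 (begin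
    ν                       ≡⟨ c*δ≡ν ⟨
    ν ℚ.* ℚ.1/ δ ℚ.* δ      ≡⟨ cong (ℚ._* δ) c≡0 ⟩
    0ℚ ℚ.* δ                ≡⟨ ℚ.*-zeroˡ δ ⟩
    0ℚ                      ∎)

monomialFrac⇒isMonomial : ∀ {F e} → MonomialFrac F e → Σ ℚ λ c → c ≢ 0ℚ × IsMonomial F c e
monomialFrac⇒isMonomial (_/_ {N} {D} {d} {d′} mN mD) =
  c , c≢0 , homogeneous-≈₁ (proj₁ (monomial-prod1 mN)) homogeneous totals
  where
  open ≡-Reasoning
  quotient = nonzero-quotient (proj₂ (monomial-prod1 mN)) (proj₂ (monomial-prod1 mD))
  c = proj₁ quotient
  c≢0 = proj₁ (proj₂ quotient)
  cz^e = (c , d - d′) ∷ []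
  homogeneous : Homogeneous d (mul1 cz^e (prod1 D))
  homogeneous = subst (λ x → Homogeneous x (mul1 cz^e (prod1 D))) (cancel d d′)
                      (homogeneous-mul1 {P = cz^e} (refl ∷ []) (proj₁ (monomial-prod1 mD)))
    where
    cancel : ∀ d d′ → (d - d′) + d′ ≡ d
    cancel = solve-∀
  totals : total (prod1 N) ≡ total (mul1 cz^e (prod1 D))
  totals = begin
    total (prod1 N)                      ≡⟨ proj₂ (proj₂ quotient) ⟨
    c ℚ.* total (prod1 D)                ≡⟨ cong (ℚ._* total (prod1 D)) (ℚ.+-identityʳ c) ⟨
    (c ℚ.+ 0ℚ) ℚ.* total (prod1 D)       ≡⟨ total-mul1 cz^e (prod1 D) ⟨
    total (mul1 cz^e (prod1 D))          ∎

-- Pairings, wedges and rays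

infixl 6 _-ᵥ_
_-ᵥ_ : Vec2 → Vec2 → Vec2
(a , b) -ᵥ (c , d) = (a - c , b - d)

-ᵥ_ : Vec2 → Vec2
-ᵥ (a , b) = (- a , - b)

perp : Vec2 → Vec2
perp (a , b) = (- b , a)

⟪⟫-distribˡ--ᵥ : ∀ l u w → ⟪ l , u -ᵥ w ⟫ ≡ ⟪ l , u ⟫ - ⟪ l , w ⟫
⟪⟫-distribˡ--ᵥ (a , b) (u₁ , u₂) (w₁ , w₂) = identity a b u₁ u₂ w₁ w₂
  where
  identity : ∀ a b u₁ u₂ w₁ w₂ →
             a * (u₁ - w₁) + b * (u₂ - w₂) ≡ (a * u₁ + b * u₂) - (a * w₁ + b * w₂)
  identity = solve-∀

∧-perp : ∀ l d → l ∧ perp d ≡ ⟪ l , d ⟫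
∧-perp (a , b) (d₁ , d₂) = identity a b d₁ d₂
  where
  identity : ∀ a b d₁ d₂ → a * d₁ - b * (- d₂) ≡ a * d₁ + b * d₂
  identity = solve-∀

∧-self : ∀ l → l ∧ l ≡ + 0
∧-self (a , b) = identity a b
  where
  identity : ∀ a b → a * b - b * a ≡ + 0
  identity = solve-∀

∧-antisym : ∀ u v → u ∧ v ≡ - (v ∧ u)
∧-antisym (a , b) (c , d) = identity a b c d
  where
  identity : ∀ a b c d → a * d - b * c ≡ - (c * b - d * a)
  identity = solve-∀

binet-cauchy : ∀ l m α β → ⟪ l , α ⟫ * ⟪ m , β ⟫ - ⟪ l , β ⟫ * ⟪ m , α ⟫ ≡ (m ∧ l) * (β ∧ α)
binet-cauchy (l₁ , l₂) (m₁ , m₂) (a₁ , a₂) (b₁ , b₂) = identity l₁ l₂ m₁ m₂ a₁ a₂ b₁ b₂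
  where
  identity : ∀ l₁ l₂ m₁ m₂ a₁ a₂ b₁ b₂ →
             (l₁ * a₁ + l₂ * a₂) * (m₁ * b₁ + m₂ * b₂) - (l₁ * b₁ + l₂ * b₂) * (m₁ * a₁ + m₂ * a₂)
             ≡ (m₁ * l₂ - m₂ * l₁) * (b₁ * a₂ - b₂ * a₁)
  identity = solve-∀

0≤i*i : ∀ i → + 0 ≤ i * i
0≤i*i (+ ℕ.zero)  = ℤ.+≤+ ℕ.z≤n
0≤i*i (+ ℕ.suc _) = ℤ.+≤+ ℕ.z≤n
0≤i*i -[1+ _ ]    = ℤ.+≤+ ℕ.z≤n

0<i*i : ∀ {i} → i ≢ + 0 → + 0 < i * i
0<i*i {+ ℕ.zero}  i≢0 = ⊥-elim (i≢0 refl)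
0<i*i {+ ℕ.suc _} _   = ℤ.+<+ (ℕ.s≤s ℕ.z≤n)
0<i*i { -[1+ _ ]} _   = ℤ.+<+ (ℕ.s≤s ℕ.z≤n)

0<⟪s,s⟫ : ∀ s → NonzeroV s → + 0 < ⟪ s , s ⟫
0<⟪s,s⟫ (a , b) s≢0 with a ≟ + 0 | b ≟ + 0
... | yes a≡0 | yes b≡0 = ⊥-elim (s≢0 (a≡0 , b≡0))
... | no a≢0  | _       = ℤ.+-mono-<-≤ (0<i*i a≢0) (0≤i*i b)
... | yes _   | no b≢0  = ℤ.+-mono-≤-< (0≤i*i a) (0<i*i b≢0)

primitive⇒nonzero : ∀ {l} → Primitive l → NonzeroV l
primitive⇒nonzero gcd≡1 (refl , refl) with gcd≡1
... | ()

<⇒0<- : ∀ {x y} → x < y → + 0 < y - x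
<⇒0<- {x} {y} x<y = subst (_< y - x) (ℤ.+-inverseʳ x) (ℤ.+-monoˡ-< (- x) x<y)

<⇒-<0 : ∀ {x y} → x < y → x - y < + 0
<⇒-<0 {x} {y} x<y = subst (x - y <_) (ℤ.+-inverseʳ y) (ℤ.+-monoˡ-< (- y) x<y)

-- ⟨s,s⟩ λ = ⟨s,λ⟩ s + (λ ∧ s) (s₂ , - s₁), so for λ ∧ s = 0 the sign of ⟨s,λ⟩ decides.
parallel⇒sameRay⊎opposite : ∀ l s → NonzeroV l → NonzeroV s → l ∧ s ≡ + 0 →
                            SameRay s l ⊎ SameRay (-ᵥ s) l
parallel⇒sameRay⊎opposite l@(a , b) s@(s₁ , s₂) l≢0 s≢0 l∧s≡0 =
  rays ⟪ s , l ⟫ ⟪ s , s ⟫ (0<⟪s,s⟫ s s≢0) scale₁ scale₂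
  where
  open ≡-Reasoning
  identity₁ : ∀ a b s₁ s₂ → (s₁ * s₁ + s₂ * s₂) * a
                            ≡ (s₁ * a + s₂ * b) * s₁ + (a * s₂ - b * s₁) * s₂
  identity₁ = solve-∀
  identity₂ : ∀ a b s₁ s₂ → (s₁ * s₁ + s₂ * s₂) * b
                            ≡ (s₁ * a + s₂ * b) * s₂ - (a * s₂ - b * s₁) * s₁
  identity₂ = solve-∀
  scale₁ : ⟪ s , s ⟫ * a ≡ ⟪ s , l ⟫ * s₁
  scale₁ = begin
    ⟪ s , s ⟫ * a                    ≡⟨ identity₁ a b s₁ s₂ ⟩
    ⟪ s , l ⟫ * s₁ + (l ∧ s) * s₂    ≡⟨ cong (λ w → ⟪ s , l ⟫ * s₁ + w * s₂) l∧s≡0 ⟩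
    ⟪ s , l ⟫ * s₁ + + 0             ≡⟨ ℤ.+-identityʳ _ ⟩
    ⟪ s , l ⟫ * s₁                   ∎
  scale₂ : ⟪ s , s ⟫ * b ≡ ⟪ s , l ⟫ * s₂
  scale₂ = begin
    ⟪ s , s ⟫ * b                    ≡⟨ identity₂ a b s₁ s₂ ⟩
    ⟪ s , l ⟫ * s₂ - (l ∧ s) * s₁    ≡⟨ cong (λ w → ⟪ s , l ⟫ * s₂ - w * s₁) l∧s≡0 ⟩
    ⟪ s , l ⟫ * s₂ + + 0             ≡⟨ ℤ.+-identityʳ _ ⟩
    ⟪ s , l ⟫ * s₂                   ∎
  vanishes : ∀ {j x} → + ℕ.suc j * x ≡ + 0 → x ≡ + 0
  vanishes {j} eq with ℤ.i*j≡0⇒i≡0∨j≡0 (+ ℕ.suc j) eq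
  ... | inj₂ x≡0 = x≡0
  moveSign : ∀ k x → + ℕ.suc k * - x ≡ -[1+ k ] * x
  moveSign k x = trans (sym (ℤ.neg-distribʳ-* (+ ℕ.suc k) x)) (ℤ.neg-distribˡ-* (+ ℕ.suc k) x)
  rays : ∀ P Q → + 0 < Q → Q * a ≡ P * s₁ → Q * b ≡ P * s₂ → SameRay s l ⊎ SameRay (-ᵥ s) l
  rays _            (+ ℕ.zero)  (ℤ.+<+ ()) _ _
  rays _            -[1+ _ ]    ()         _ _
  rays (+ ℕ.suc k)  (+ ℕ.suc j) _ e₁ e₂ = inj₁ (k , j , sym e₁ , sym e₂)
  rays (+ ℕ.zero)   (+ ℕ.suc j) _ e₁ e₂ = ⊥-elim (l≢0 (vanishes {j} e₁ , vanishes {j} e₂))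
  rays -[1+ k ]     (+ ℕ.suc j) _ e₁ e₂ =
    inj₂ (k , j , trans (moveSign k s₁) (sym e₁) , trans (moveSign k s₂) (sym e₂))

half-self : ∀ l → NonzeroV l → half l l ≡ 0
half-self l l≢0 with + 0 <? l ∧ l | l ∧ l ≟ + 0 | + 0 <? ⟪ l , l ⟫
... | yes _ | _           | _     = refl
... | no _  | yes _       | yes _ = refl
... | no _  | no l∧l≢0    | _     = ⊥-elim (l∧l≢0 (∧-self l))
... | no _  | yes _       | no ≯0 = ⊥-elim (≯0 (0<⟪s,s⟫ l l≢0))

half-pos : ∀ l v → + 0 < l ∧ v → half l v ≡ 0
half-pos l v 0<l∧v with + 0 <? l ∧ v
... | yes _  = refl
... | no ≯0 = ⊥-elim (≯0 0<l∧v)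

half≡0⊎half≡1 : ∀ l v → half l v ≡ 0 ⊎ half l v ≡ 1
half≡0⊎half≡1 l v with + 0 <? l ∧ v | l ∧ v ≟ + 0 | + 0 <? ⟪ l , v ⟫
... | yes _ | _     | _     = inj₁ refl
... | no _  | yes _ | yes _ = inj₁ refl
... | no _  | yes _ | no _  = inj₂ refl
... | no _  | no _  | _     = inj₂ refl

inOpenArc : ∀ {l l′ r} → NonzeroV l → + 0 < l ∧ r → l′ ∧ r < + 0 → InOpenArc l l′ r
inOpenArc {l} {l′} {r} l≢0 0<l∧r l′∧r<0 =
  inj₂ (trans (half-self l l≢0) (sym half-r) , 0<l∧r) , beforeL′ (half≡0⊎half≡1 l l′)
  where
  half-r = half-pos l r 0<l∧r
  beforeL′ : half l l′ ≡ 0 ⊎ half l l′ ≡ 1 → AngleLT l r l′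
  beforeL′ (inj₁ ≡0) =
    inj₂ (trans half-r (sym ≡0) , subst (+ 0 <_) (sym (∧-antisym r l′)) (ℤ.neg-mono-< l′∧r<0))
  beforeL′ (inj₂ ≡1) = inj₁ (subst₂ ℕ._<_ (sym half-r) (sym ≡1) (ℕ.s≤s ℕ.z≤n))

-- Walls

wall : Vec2 → Vec2 → Vec2
wall u w = perp (u -ᵥ w)

∧-wall : ∀ l u w → l ∧ wall u w ≡ ⟪ l , u ⟫ - ⟪ l , w ⟫
∧-wall l u w = trans (∧-perp l (u -ᵥ w)) (⟪⟫-distribˡ--ᵥ l u w)

-ᵥ-wall : ∀ u w → -ᵥ wall u w ≡ wall w u
-ᵥ-wall (u₁ , u₂) (w₁ , w₂) = cong₂ _,_ (identity₁ u₂ w₂) (identity₂ u₁ w₁)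
  where
  identity₁ : ∀ x y → - (- (x - y)) ≡ - (y - x)
  identity₁ = solve-∀
  identity₂ : ∀ x y → - (x - y) ≡ y - x
  identity₂ = solve-∀

wall-nonzero : ∀ {u w} → u ≢ w → NonzeroV (wall u w)
wall-nonzero {u₁ , u₂} {w₁ , w₂} u≢w (e₂ , e₁) =
  u≢w (cong₂ _,_ (ℤ.i-j≡0⇒i≡j u₁ w₁ e₁) (ℤ.i-j≡0⇒i≡j u₂ w₂ (ℤ.neg-injective e₂)))

nonzero? : ∀ v → Dec (NonzeroV v)
nonzero? (a , b) = ¬? ((a ≟ + 0) ×-dec (b ≟ + 0))

-- ℝ₊ (wall u w) and ℝ₊ (wall w u) are the two rays of directions λ with ⟨λ,u⟩ = ⟨λ,w⟩.
walls : List Vec2 → List Vec2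
walls E = filter nonzero? (cartesianProductWith wall E E)

walls-nonzero : ∀ E → All NonzeroV (walls E)
walls-nonzero E = All.all-filter nonzero? (cartesianProductWith wall E E)

wall-∈-walls : ∀ {E u w} → u ∈ E → w ∈ E → u ≢ w → wall u w ∈ walls E
wall-∈-walls u∈ w∈ u≢w = ∈-filter⁺ nonzero? (∈-cartesianProductWith⁺ wall u∈ w∈) (wall-nonzero u≢w)

Separates : Vec2 → List Vec2 → Set
Separates l E = ∀ {u w} → u ∈ E → w ∈ E → ⟪ l , u ⟫ ≡ ⟪ l , w ⟫ → u ≡ w

separates-⊆ : ∀ {l E F} → Separates l E → F ⊆ E → Separates l F
separates-⊆ sep F⊆E u∈ w∈ = sep (F⊆E u∈) (F⊆E w∈)

offWalls⇒separates : ∀ l {E} → NonzeroV l → OffRays (walls E) l → Separates l E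
offWalls⇒separates l l≢0 off {u} {w} u∈ w∈ ⟪l,u⟫≡⟪l,w⟫ = decidable-stable (u ≟v w) onWall
  where
  l∧wall≡0 : l ∧ wall u w ≡ + 0
  l∧wall≡0 = trans (∧-wall l u w) (trans (cong (_- ⟪ l , w ⟫) ⟪l,u⟫≡⟪l,w⟫) (ℤ.+-inverseʳ ⟪ l , w ⟫))
  onWall : ¬ u ≢ w
  onWall u≢w =
    [ All.lookup off (wall-∈-walls u∈ w∈ u≢w)
    , All.lookup off (wall-∈-walls w∈ u∈ (u≢w ∘ sym)) ∘ subst (λ σ → SameRay σ l) (-ᵥ-wall u w)
    ]′ (parallel⇒sameRay⊎opposite l (wall u w) l≢0 (wall-nonzero u≢w) l∧wall≡0)

-- Vertices of Newton polygons

extremal : Vec2 → List Vec2 → Vec2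
extremal l []      = (+ 0 , + 0)
extremal l (χ ∷ E) = argmax ⟪ l ,_⟫ χ E

extremal-∈ : ∀ l {χ E} → χ ∈ E → extremal l E ∈ E
extremal-∈ l {E = χ ∷ E} _ = [ here , there ]′ (argmax-sel ⟪ l ,_⟫ χ E)

extremal-maximal : ∀ l E → All (λ χ → ⟪ l , χ ⟫ ≤ ⟪ l , extremal l E ⟫) E
extremal-maximal l []      = []
extremal-maximal l (χ ∷ E) = f[⊥]≤f[argmax] {f = ⟪ l ,_⟫} χ E ∷ f[xs]≤f[argmax] {f = ⟪ l ,_⟫} χ E

extremal-strict : ∀ {l E χ} → Separates l E → χ ∈ E → χ ≢ extremal l E →
                  ⟪ l , χ ⟫ < ⟪ l , extremal l E ⟫
extremal-strict {l} {E} sep χ∈ χ≢ =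
  ℤ.≤∧≢⇒< (All.lookup (extremal-maximal l E) χ∈) (χ≢ ∘ sep χ∈ (extremal-∈ l χ∈))

minℤ-≤ : ∀ {y ys} → y ∈ ys → minℤ ys ≤ y
minℤ-≤ {ys = x ∷ []}     (here refl)    = ℤ.≤-refl
minℤ-≤ {ys = x ∷ y ∷ ys} (here refl)    = ℤ.i⊓j≤i x (minℤ (y ∷ ys))
minℤ-≤ {ys = x ∷ y ∷ ys} (there y∈)     = ℤ.≤-trans (ℤ.i⊓j≤j x (minℤ (y ∷ ys))) (minℤ-≤ y∈)

minℤ-∈ : ∀ {y ys} → y ∈ ys → minℤ ys ∈ ys
minℤ-∈ {ys = x ∷ []}     _ = here refl
minℤ-∈ {ys = x ∷ y ∷ ys} _ =
  [ here , there ∘ (λ eq → subst (_∈ y ∷ ys) (sym eq) (minℤ-∈ {ys = y ∷ ys} (here refl))) ]′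
  (ℤ.⊓-sel x (minℤ (y ∷ ys)))

minℤ-least : ∀ {y ys} → y ∈ ys → All (y ≤_) ys → minℤ ys ≡ y
minℤ-least y∈ y≤ys = ℤ.≤-antisym (minℤ-≤ y∈) (All.lookup y≤ys (minℤ-∈ y∈))

exponents : LP2 → List Vec2
exponents = map proj₂

Generic : Vec2 → LP2 → Set
Generic l p = OffRays (walls (exponents p)) l

SameChamber : Vec2 → Vec2 → LP2 → Set
SameChamber l l′ p =
  Generic l p × Generic l′ p × All (λ σ → ¬ InOpenArc l l′ σ) (walls (exponents p))

initialExponent : Vec2 → LP2 → Vec2
initialExponent l p = extremal l (support p)

support⊆exponents : ∀ p → support p ⊆ exponents p
support⊆exponents p = proj₁ ∘ ∈-filter⁻ (λ χ → ¬? (coeff2 p χ ℚ.≟ 0ℚ)) {xs = exponents p}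

∈support⇒coeff2≢0 : ∀ p {χ} → χ ∈ support p → coeff2 p χ ≢ 0ℚ
∈support⇒coeff2≢0 p = proj₂ ∘ ∈-filter⁻ (λ χ → ¬? (coeff2 p χ ℚ.≟ 0ℚ)) {xs = exponents p}

coeff2≢0⇒∈exponents : ∀ p {χ} → coeff2 p χ ≢ 0ℚ → χ ∈ exponents p
coeff2≢0⇒∈exponents []      c≢0 = ⊥-elim (c≢0 refl)
coeff2≢0⇒∈exponents (t ∷ p) {χ} c≢0 with proj₂ t ≟v χ
... | yes t≡χ = here (sym t≡χ)
... | no _    = there (coeff2≢0⇒∈exponents p c≢0)

initialExponent-∈ : ∀ l p → NonzeroLP2 p → initialExponent l p ∈ support p
initialExponent-∈ l p (χ , c≢0) =
  extremal-∈ l (∈-filter⁺ (λ χ → ¬? (coeff2 p χ ℚ.≟ 0ℚ)) (coeff2≢0⇒∈exponents p c≢0) c≢0)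

val-initialExponent : ∀ l p → NonzeroLP2 p → val l p ≡ - ⟪ l , initialExponent l p ⟫
val-initialExponent l p p≢0 =
  minℤ-least (∈-map⁺ (λ χ → - ⟪ l , χ ⟫) (initialExponent-∈ l p p≢0))
             (All.map⁺ (All.map ℤ.neg-mono-≤ (extremal-maximal l (support p))))

-- initRestr l m p unfolds to map (map₂ ⟪ m ,_⟫) (initialTerms l (val l p) p).
initialTerms : Vec2 → ℤ → LP2 → LP2
initialTerms l v = filter (λ t → - ⟪ l , proj₂ t ⟫ ≟ v)

homogeneous-initialTerms : ∀ l {v χ} q → All (λ t → - ⟪ l , proj₂ t ⟫ ≡ v → proj₂ t ≡ χ) q →
                           Homogeneous χ (initialTerms l v q)
homogeneous-initialTerms l {v} q unique =
  All.zipWith (λ (onLevel⇒χ , onLevel) → onLevel⇒χ onLevel)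
              (All.filter⁺ onLevel? unique , All.all-filter onLevel? q)
  where
  onLevel? : ∀ t → Dec (- ⟪ l , proj₂ t ⟫ ≡ v)
  onLevel? t = - ⟪ l , proj₂ t ⟫ ≟ v

total-initialTerms : ∀ l {v χ} q → - ⟪ l , χ ⟫ ≡ v →
                     All (λ t → - ⟪ l , proj₂ t ⟫ ≡ v → proj₂ t ≡ χ) q →
                     total (initialTerms l v q) ≡ coeff2 q χ
total-initialTerms l [] _ [] = refl
total-initialTerms l {v} {χ} (t ∷ q) χ-onLevel (unique ∷ uniques)
  with - ⟪ l , proj₂ t ⟫ ≟ v | proj₂ t ≟v χ
... | yes _          | yes _    = cong (proj₁ t ℚ.+_) (total-initialTerms l q χ-onLevel uniques)
... | yes t-onLevel  | no t≢χ   = ⊥-elim (t≢χ (unique t-onLevel))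
... | no t-offLevel  | yes refl = ⊥-elim (t-offLevel χ-onLevel)
... | no _           | no _     = total-initialTerms l q χ-onLevel uniques

initRestr-monomial : ∀ {l} m p → NonzeroV l → Generic l p → NonzeroLP2 p →
                     Monomial ⟪ m , initialExponent l p ⟫ (initRestr l m p)
initRestr-monomial {l} m p l≢0 generic p≢0 =
  homogeneous-map₂ ⟪ m ,_⟫ (homogeneous-initialTerms l p unique) ,
  subst (_≢ 0ℚ) (sym total≡coeff) (∈support⇒coeff2≢0 p χ∈)
  where
  χ = initialExponent l p
  χ∈ = initialExponent-∈ l p p≢0
  val≡ = val-initialExponent l p p≢0
  unique′ : All (λ χ′ → - ⟪ l , χ′ ⟫ ≡ val l p → χ′ ≡ χ) (exponents p)
  unique′ = All.tabulate λ χ′∈ onLevel →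
    offWalls⇒separates l l≢0 generic χ′∈ (support⊆exponents p χ∈)
                       (ℤ.neg-injective (trans onLevel val≡))
  unique = All.map⁻ unique′
  total≡coeff : total (initRestr l m p) ≡ coeff2 p χ
  total≡coeff = trans (total-map₂ ⟪ m ,_⟫ (initialTerms l (val l p) p))
                      (total-initialTerms l p (sym val≡) unique)

initialExponent-locallyConstant : ∀ {l l′} p → NonzeroV l → NonzeroV l′ → SameChamber l l′ p →
                                  NonzeroLP2 p → initialExponent l p ≡ initialExponent l′ p
initialExponent-locallyConstant {l} {l′} p l≢0 l′≢0 (generic , generic′ , noWall) p≢0 =
  decidable-stable (u ≟v w) noJump
  where
  u = initialExponent l p
  w = initialExponent l′ p
  u∈ = initialExponent-∈ l p p≢0
  w∈ = initialExponent-∈ l′ p p≢0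
  sep = separates-⊆ {l} (offWalls⇒separates l l≢0 generic) (support⊆exponents p)
  sep′ = separates-⊆ {l′} (offWalls⇒separates l′ l′≢0 generic′) (support⊆exponents p)
  noJump : ¬ u ≢ w
  noJump u≢w =
    All.lookup noWall (wall-∈-walls (support⊆exponents p u∈) (support⊆exponents p w∈) u≢w)
      (inOpenArc l≢0
        (subst (+ 0 <_) (sym (∧-wall l u w)) (<⇒0<- (extremal-strict sep w∈ (u≢w ∘ sym))))
        (subst (_< + 0) (sym (∧-wall l′ u w)) (<⇒-<0 (extremal-strict sep′ u∈ u≢w))))

-- Tame symbols

initialExponentF : Vec2 → RatFun× → Vec2
initialExponentF l f = initialExponent l (num f) -ᵥ initialExponent l (den f)

valF-initialExponentF : ∀ l f → valF l f ≡ - ⟪ l , initialExponentF l f ⟫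
valF-initialExponentF l f = begin
  val l (num f) - val l (den f)
    ≡⟨ cong₂ _-_ (val-initialExponent l (num f) (num≢0 f))
                 (val-initialExponent l (den f) (den≢0 f)) ⟩
  - ⟪ l , a ⟫ - - ⟪ l , b ⟫     ≡⟨ identity ⟪ l , a ⟫ ⟪ l , b ⟫ ⟩
  - (⟪ l , a ⟫ - ⟪ l , b ⟫)      ≡⟨ cong -_ (⟪⟫-distribˡ--ᵥ l a b) ⟨
  - ⟪ l , a -ᵥ b ⟫               ∎
  where
  open ≡-Reasoning
  a = initialExponent l (num f)
  b = initialExponent l (den f)
  identity : ∀ x y → - x - - y ≡ - (x - y)
  identity = solve-∀

powFrac-monomial : ∀ {l} m f → NonzeroV l → Generic l (num f) → Generic l (den f) → ∀ k →
  MonomialFrac (powFrac (initRestr l m (num f)) (initRestr l m (den f)) k)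
               (k * ⟪ m , initialExponentF l f ⟫)
powFrac-monomial {l} m f l≢0 genericN genericD k =
  subst (MonomialFrac _) (cong (k *_) (sym (⟪⟫-distribˡ--ᵥ m _ _)))
    (monomialFrac-powFrac (initRestr-monomial m (num f) l≢0 genericN (num≢0 f))
                          (initRestr-monomial m (den f) l≢0 genericD (den≢0 f)) k)

tameSymbol-monomial : ∀ {l} m f g → NonzeroV l → m ∧ l ≡ + 1 →
  Generic l (num f) → Generic l (den f) → Generic l (num g) → Generic l (den g) →
  MonomialFrac (tameSymbol l m (f , g)) (initialExponentF l g ∧ initialExponentF l f)
tameSymbol-monomial {l} m f g l≢0 m∧l≡1 genericNf genericDf genericNg genericDg =
  subst (MonomialFrac _) degree
    (monomialFrac-⊗ (monomialFrac-sign ⌊ ℤ.∣ valF l f * valF l g ∣ ℕ.% 2 ℕ.≟ 1 ⌋)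
      (monomialFrac-⊗ (powFrac-monomial m f l≢0 genericNf genericDf (valF l g))
                      (powFrac-monomial m g l≢0 genericNg genericDg (- valF l f))))
  where
  open ≡-Reasoning
  α = initialExponentF l f
  β = initialExponentF l g
  rearrange : ∀ a b c d → + 0 + (- b * c + - - a * d) ≡ a * d - b * c
  rearrange = solve-∀
  degree : + 0 + (valF l g * ⟪ m , α ⟫ + - valF l f * ⟪ m , β ⟫) ≡ β ∧ α
  degree = begin
    + 0 + (valF l g * ⟪ m , α ⟫ + - valF l f * ⟪ m , β ⟫)
      ≡⟨ cong₂ (λ x y → + 0 + (x * ⟪ m , α ⟫ + - y * ⟪ m , β ⟫))
               (valF-initialExponentF l g) (valF-initialExponentF l f) ⟩
    + 0 + (- ⟪ l , β ⟫ * ⟪ m , α ⟫ + - - ⟪ l , α ⟫ * ⟪ m , β ⟫)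
      ≡⟨ rearrange ⟪ l , α ⟫ ⟪ l , β ⟫ ⟪ m , α ⟫ ⟪ m , β ⟫ ⟩
    ⟪ l , α ⟫ * ⟪ m , β ⟫ - ⟪ l , β ⟫ * ⟪ m , α ⟫
      ≡⟨ binet-cauchy l m α β ⟩
    (m ∧ l) * (β ∧ α)
      ≡⟨ cong (_* (β ∧ α)) m∧l≡1 ⟩
    + 1 * (β ∧ α)
      ≡⟨ ℤ.*-identityˡ (β ∧ α) ⟩
    β ∧ α ∎

symbolPolynomials : Symbol → List LP2
symbolPolynomials (f , g) = num f ∷ den f ∷ num g ∷ den g ∷ []

polynomials : List Symbol → List LP2
polynomials = concatMap symbolPolynomials

residueDegree : Vec2 → List Symbol → ℤ
residueDegree l []            = + 0
residueDegree l ((f , g) ∷ κ) = initialExponentF l g ∧ initialExponentF l f + residueDegree l κ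

residue-monomial : ∀ {l} m κ → NonzeroV l → m ∧ l ≡ + 1 → All (Generic l) (polynomials κ) →
                   MonomialFrac (residue l m κ) (residueDegree l κ)
residue-monomial m []            _   _      _ = [] / []
residue-monomial m ((f , g) ∷ κ) l≢0 m∧l≡1 (gNf ∷ gDf ∷ gNg ∷ gDg ∷ generic) =
  monomialFrac-⊗ (tameSymbol-monomial m f g l≢0 m∧l≡1 gNf gDf gNg gDg)
                 (residue-monomial m κ l≢0 m∧l≡1 generic)

residueDegree-locallyConstant : ∀ {l l′} κ → NonzeroV l → NonzeroV l′ →
  All (SameChamber l l′) (polynomials κ) → residueDegree l κ ≡ residueDegree l′ κ
residueDegree-locallyConstant []            _   _    _ = refl
residueDegree-locallyConstant {l} {l′} ((f , g) ∷ κ) l≢0 l′≢0 (cNf ∷ cDf ∷ cNg ∷ cDg ∷ cκ) =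
  cong₂ _+_ (cong₂ _∧_ (constant g cNg cDg) (constant f cNf cDf))
            (residueDegree-locallyConstant κ l≢0 l′≢0 cκ)
  where
  constant : ∀ f → SameChamber l l′ (num f) → SameChamber l l′ (den f) →
             initialExponentF l f ≡ initialExponentF l′ f
  constant f cN cD = cong₂ _-ᵥ_ (initialExponent-locallyConstant (num f) l≢0 l′≢0 cN (num≢0 f))
                                (initialExponent-locallyConstant (den f) l≢0 l′≢0 cD (den≢0 f))

proposition5p1 : (κ : List Symbol) →
    Σ (List Vec2) λ Σs → All NonzeroV Σs × Σ (Vec2 → ℤ) λ n → LocallyConstantOff Σs n ×
      (∀ l → Primitive l → OffRays Σs l → ∀ m → m ∧ l ≡ + 1 →
        Σ ℚ λ c → c ≢ 0ℚ × IsMonomial (residue l m κ) c (n l))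
proposition5p1 κ =
    Σs
  , All.concat⁺ (All.map⁺ (All.universal (walls-nonzero ∘ exponents) (polynomials κ)))
  , (λ l → residueDegree l κ)
  , (λ l l′ prim prim′ off off′ noWall →
       residueDegree-locallyConstant κ (primitive⇒nonzero prim) (primitive⇒nonzero prim′)
         (All.zip (perPolynomial off , All.zip (perPolynomial off′ , perPolynomial noWall))))
  , (λ l prim off m m∧l≡1 →
       monomialFrac⇒isMonomial
         (residue-monomial m κ (primitive⇒nonzero prim) m∧l≡1 (perPolynomial off)))
  where
  Σs = concatMap (walls ∘ exponents) (polynomials κ)
  perPolynomial : ∀ {P : Vec2 → Set} → All P Σs →
                  All (λ p → All P (walls (exponents p))) (polynomials κ)
  perPolynomial = All.map⁻ ∘ All.concat⁻
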